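{- Let $V$ be a $v$-dimensional vector space over $\mathrm{GF}(q)$, let $\{\mathbf 0\}=U_0<U_1<\dots<U_v=V$ be a maximal chain of subspaces of $V$, $k\in\{0,\dots,v\}$ and $s\in\{0,\dots,v-k-1\}$. Then the set of $k$-dimensional subspaces of $V$ is the disjoint union \[\genfrac{[}{]}{0pt}{}{V}{k}_q=\bigcup_{i=0}^k\genfrac{[}{]}{0pt}{}{U_{s+i}}{i}_q *_{\overline{U_{s+i+1}/U_{s+i}}}\genfrac{[}{]}{0pt}{}{V/U_{s+i+1}}{k-i}_q,\] and consequently \[\begin{bmatrix} v\\ k\end{bmatrix}_q=\sum_{i=0}^k q^{(s+1)(k-i)}\begin{bmatrix} s+i\\ i\end{bmatrix}_q\begin{bmatrix} v-s-i-1\\ k-i\end{bmatrix}_q.\]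
   Context: $\genfrac{[}{]}{0pt}{}{W}{j}_q$ denotes the set of $j$-dimensional subspaces of a $\mathrm{GF}(q)$-vector space $W$, and $\begin{bmatrix} a\\ b\end{bmatrix}_q$ its size (Gaussian binomial coefficient). For $U_1\le U_2\le V$, a subspace $K\le V$ avoids the factor $U_2/U_1$ if $U_1\cap K=U_2\cap K$. For $K_1\le U_1$ and $U_2\le K_2\le V$, the avoiding join is $K_1 *_{\overline{U_2/U_1}} K_2/U_2=\{K\le V: U_1\cap K=K_1,\ U_2+K=K_2,\ K\text{ avoids }U_2/U_1\}$. For a set $\mathcal{B}^{(1)}$ of subspaces of $U_1$ and a set $\mathcal{B}^{(2)}$ of subspaces of $V/U_2$, $\mathcal{B}^{(1)} *_{\overline{U_2/U_1}}\mathcal{B}^{(2)}$ is the union of $B^{(1)} *_{\overline{U_2/U_1}} K_2/U_2$ over all $B^{(1)}\in\mathcal{B}^{(1)}$ and all $K_2\ge U_2$ with $K_2/U_2\in\mathcal{B}^{(2)}$ (empty if either set is empty). -}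

module Defs where

open import Level using (0ℓ)
open import Data.Nat using (ℕ; zero; suc; _^_; _≤_) renaming (_+_ to _+ℕ_; _*_ to _*ℕ_)
open import Data.Fin using (Fin)
open import Data.Vec using (Vec; []; _∷_; zipWith; map; replicate)
open import Data.Vec.Relation.Unary.All using (All)
open import Data.Product using (Σ; _×_; ∃)
open import Relation.Binary.PropositionalEquality using (_≡_; _≢_)
open import Relation.Nullary using (¬_)
open import Function.Bundles using (_↔_; _⇔_)
open import Algebra.Structures using (IsCommutativeRing)

record FiniteField (q : ℕ) : Set₁ where
  infixl 6 _+_
  infixl 7 _*_
  field
    Carrier : Set
    _+_ _*_ : Carrier → Carrier → Carrier
    -_      : Carrier → Carrier
    0# 1#   : Carrier
    isCommutativeRing : IsCommutativeRing _≡_ _+_ _*_ -_ 0# 1#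
    0≢1     : 0# ≢ 1#
    inverse : ∀ x → x ≢ 0# → Σ Carrier (λ y → x * y ≡ 1#)
    enum    : Fin q ↔ Carrier

module Lin {q : ℕ} (F : FiniteField q) where
  open FiniteField F renaming (Carrier to K; _+_ to _+F_; _*_ to _*F_; -_ to -F_)

  Vect : ℕ → Set
  Vect v = Vec K v

  𝟎 : ∀ {v} → Vect v
  𝟎 = replicate _ 0#

  _⊕_ : ∀ {v} → Vect v → Vect v → Vect v
  _⊕_ = zipWith _+F_

  _·_ : ∀ {v} → K → Vect v → Vect v
  c · x = map (c *F_) x

  _⊖_ : ∀ {v} → Vect v → Vect v → Vect v
  x ⊖ y = x ⊕ ((-F 1#) · y)

  lincomb : ∀ {v d} → Vec K d → Vec (Vect v) d → Vect v
  lincomb []       []       = 𝟎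
  lincomb (c ∷ cs) (b ∷ bs) = (c · b) ⊕ lincomb cs bs

  record Subspace (v : ℕ) : Set₁ where
    field
      mem  : Vect v → Set
      0∈   : mem 𝟎
      +∈   : ∀ {x y} → mem x → mem y → mem (x ⊕ y)
      ·∈   : ∀ c {x} → mem x → mem (c · x)
  open Subspace public

  IsZero : ∀ {v} → Vect v → Set
  IsZero x = x ≡ 𝟎

  -- DimMod Z W d : the quotient W/Z has dimension d, i.e. there are
  -- d vectors of W whose classes mod Z are linearly independent and
  -- span W/Z.  (Z ⊆ W is assumed where used.)
  DimMod : ∀ {v} → (Vect v → Set) → (Vect v → Set) → ℕ → Set
  DimMod {v} Z W d =
    Σ (Vec (Vect v) d) λ b →
      All W b
      × (∀ (c : Vec K d) → Z (lincomb c b) → c ≡ replicate d 0#)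
      × (∀ x → W x → Σ (Vec K d) λ c → Z (x ⊖ lincomb c b))

  Dim : ∀ {v} → Subspace v → ℕ → Set
  Dim W d = DimMod IsZero (mem W) d

  _⊆_ : ∀ {v} → Subspace v → Subspace v → Set
  A ⊆ B = ∀ x → mem A x → mem B x

  _∩_≐_ : ∀ {v} → Subspace v → Subspace v → Subspace v → Set
  A ∩ B ≐ C = ∀ x → (mem A x × mem B x) ⇔ mem C x

  _+_≐_ : ∀ {v} → Subspace v → Subspace v → Subspace v → Set
  _+_≐_ {v} A B C = ∀ x →
    (Σ (Vect v) λ a → Σ (Vect v) λ b → mem A a × mem B b × x ≡ a ⊕ b) ⇔ mem C x

  Avoids : ∀ {v} → Subspace v → Subspace v → Subspace v → Set
  Avoids K U₁ U₂ = ∀ x → (mem U₁ x × mem K x) ⇔ (mem U₂ x × mem K x)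

  -- Maximal chain {0} = U₀ < U₁ < … < U_v = V (indices > v are irrelevant)
  IsMaximalChain : (v : ℕ) → (ℕ → Subspace v) → Set
  IsMaximalChain v U =
    (∀ x → mem (U 0) x ⇔ IsZero x)
    × (∀ x → mem (U v) x)
    × (∀ i → suc i ≤ v →
         (U i ⊆ U (suc i)) × Σ (Vect v) λ x → mem (U (suc i)) x × ¬ mem (U i) x)

  -- K ∈ [U₁ choose i] *_{U₂/U₁} [V/U₂ choose j], unfolded:
  -- there are B₁ ∈ [U₁ choose i] and K₂ ≥ U₂ with K₂/U₂ of dimension j
  -- such that U₁ ∩ K = B₁, U₂ + K = K₂ and K avoids U₂/U₁.
  InAvoidingJoin : ∀ {v} → (U₁ U₂ : Subspace v) → (i j : ℕ) → Subspace v → Set₁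
  InAvoidingJoin {v} U₁ U₂ i j K =
    Σ (Subspace v) λ B₁ → Σ (Subspace v) λ K₂ →
      (B₁ ⊆ U₁) × Dim B₁ i
      × (U₂ ⊆ K₂) × DimMod (mem U₂) (mem K₂) j
      × (U₁ ∩ K ≐ B₁) × (U₂ + K ≐ K₂) × Avoids K U₁ U₂

gauss : ℕ → ℕ → ℕ → ℕ
gauss q n       zero    = 1
gauss q zero    (suc k) = 0
gauss q (suc n) (suc k) = gauss q n k +ℕ q ^ suc k *ℕ gauss q n (suc k)

sumTo : (ℕ → ℕ) → ℕ → ℕ
sumTo f zero    = f 0
sumTo f (suc k) = sumTo f k +ℕ f (suc k)

-- Fix a k-dimensional K and let d m = dim (Uₘ ∩ K). Since Uₘ₊₁ = Uₘ + ⟨xₘ⟩ for one vector xₘ, d is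
-- monotone and grows by at most one per step; it is bounded by k. So j ↦ d (s + j) has a unique plateau
-- i ≤ k with d (s + i) = d (s + i + 1) = i. Equal dimensions make Uₛ₊ᵢ ∩ K = Uₛ₊ᵢ₊₁ ∩ K, i.e. K avoids
-- Uₛ₊ᵢ₊₁/Uₛ₊ᵢ, and the dimension formula dim K = dim (Uₛ₊ᵢ₊₁ ∩ K) + dim (K mod Uₛ₊ᵢ₊₁) gives the
-- quotient dimension k − i: K lies in the i-th piece. Conversely the data of a piece pin down d at
-- s + i and s + i + 1 and give dim K = i + (k − i). The counting identity is proved on its own from
-- q-Pascal's rule, by induction on k and, for the boundary term, on s.

module Submission where

open import Defs
open import Level using (0ℓ)
open import Data.Nat using (ℕ; zero; suc; _+_; _*_; _^_; _∸_; _≤_; _<_; z≤n; s≤s; _≤?_)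
import Data.Nat.Properties as ℕ
open import Data.Nat.Tactic.RingSolver using (solve-∀)
open import Data.Fin using (Fin; zero; suc)
import Data.Fin.Properties as Fin
open import Data.Vec using (Vec; []; _∷_; map; _++_; insertAt; removeAt; head; tail; lookup; splitAt)
import Data.Vec.Properties as Vec
open import Data.Vec.Relation.Unary.All using (All; []; _∷_)
import Data.Vec.Relation.Unary.All as All
import Data.Vec.Relation.Unary.All.Properties as All
open import Data.Vec.Relation.Binary.Pointwise.Inductive using (Pointwise; []; _∷_)
open import Data.Product using (Σ; ∃; _×_; _,_; proj₁; proj₂)
open import Data.Sum using (_⊎_; inj₁; inj₂)
open import Data.Maybe using (nothing)
open import Relation.Binary.PropositionalEquality
open import Relation.Binary.Definitions using (DecidableEquality; tri<; tri≈; tri>)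
open import Relation.Nullary using (¬_; Dec; yes; no; contradiction)
open import Relation.Nullary.Decidable using (_×-dec_; ¬?; via-injection)
import Relation.Nullary.Decidable as Dec
open import Relation.Unary using (Decidable)
open import Function.Bundles using (_⇔_; Inverse; Equivalence; mk⇔)
open import Function.Properties.Inverse using (↔-sym; ↔⇒↣)
open import Function.Properties.Equivalence using () renaming (refl to ⇔-refl; sym to ⇔-sym; trans to ⇔-trans)
open import Algebra.Structures using (IsCommutativeRing; IsAbelianGroup)
open import Algebra.Bundles using (CommutativeRing; AbelianGroup)
import Algebra.Properties.AbelianGroup
import Algebra.Properties.CommutativeSemigroup

module Plateau (f : ℕ → ℕ) (k : ℕ) where

  plateau-exists : (∀ j → j ≤ k → f j ≤ f (suc j)) → f (suc k) ≤ k → ∃ λ i → i ≤ k × f i ≡ i × f (suc i) ≡ i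
  plateau-exists mono f₊≤k = climb k 0 refl z≤n
    where
    climb : ∀ t j → j + t ≡ k → j ≤ f j → ∃ λ i → i ≤ k × f i ≡ i × f (suc i) ≡ i
    climb t j j+t≡k j≤f with f (suc j) ≤? j
    ... | yes f₊≤j = j , j≤k , ℕ.≤-antisym (ℕ.≤-trans (mono j j≤k) f₊≤j) j≤f , ℕ.≤-antisym f₊≤j (ℕ.≤-trans j≤f (mono j j≤k))
      where
      j≤k : j ≤ k
      j≤k = subst (j ≤_) j+t≡k (ℕ.m≤m+n j t)
    climb zero j j+0≡k _ | no f₊≰j = contradiction (subst (λ w → f (suc w) ≤ w) k≡j f₊≤k) f₊≰j
      where
      k≡j : k ≡ j
      k≡j = trans (sym j+0≡k) (ℕ.+-identityʳ j)
    climb (suc t) j j+t≡k _ | no f₊≰j = climb t (suc j) (trans (sym (ℕ.+-suc j t)) j+t≡k) (ℕ.≰⇒> f₊≰j)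

  module _ (slow : ∀ j → j ≤ k → f (suc j) ≤ suc (f j)) where

    slow-growth : ∀ i t → i + t ≤ suc k → f (i + t) ≤ f i + t
    slow-growth i zero _ rewrite ℕ.+-identityʳ i | ℕ.+-identityʳ (f i) = ℕ.≤-refl
    slow-growth i (suc t) le rewrite ℕ.+-suc i t | ℕ.+-suc (f i) t =
      ℕ.≤-trans (slow (i + t) (ℕ.≤-pred le)) (s≤s (slow-growth i t (ℕ.<⇒≤ le)))

    plateau-unique-< : ∀ {i j} → i < j → j ≤ k → f (suc i) ≡ i → f j ≢ j
    plateau-unique-< {i} (s≤s i≤j′) j≤k f₊≡i fj≡j with ℕ.m≤n⇒∃[o]m+o≡n i≤j′
    ... | t , refl = ℕ.<-irrefl fj≡j (begin-strict
      f (suc i + t) ≤⟨ slow-growth (suc i) t (ℕ.m≤n⇒m≤1+n j≤k) ⟩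
      f (suc i) + t ≡⟨ cong (_+ t) f₊≡i ⟩
      i + t         <⟨ ℕ.n<1+n (i + t) ⟩
      suc i + t     ∎)
      where open ℕ.≤-Reasoning

    plateau-unique : ∀ {i j} → i ≤ k → j ≤ k → f (suc i) ≡ i → f i ≡ i → f (suc j) ≡ j → f j ≡ j → i ≡ j
    plateau-unique {i} {j} i≤k j≤k f₊i fi f₊j fj with ℕ.<-cmp i j
    ... | tri< i<j _ _ = contradiction fj (plateau-unique-< i<j j≤k f₊i)
    ... | tri≈ _ i≡j _ = i≡j
    ... | tri> _ _ j<i = contradiction fi (plateau-unique-< j<i i≤k f₊j)

module GaussianBinomial (q : ℕ) where

  sumTo-cong : ∀ {f g : ℕ → ℕ} k → (∀ i → i ≤ k → f i ≡ g i) → sumTo f k ≡ sumTo g k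
  sumTo-cong zero    f≗g = f≗g 0 z≤n
  sumTo-cong (suc k) f≗g = cong₂ _+_ (sumTo-cong k (λ i i≤k → f≗g i (ℕ.m≤n⇒m≤1+n i≤k))) (f≗g (suc k) ℕ.≤-refl)

  sumTo-shift : ∀ f k → sumTo f (suc k) ≡ f 0 + sumTo (λ i → f (suc i)) k
  sumTo-shift f zero    = refl
  sumTo-shift f (suc k) = trans (cong (_+ f (suc (suc k))) (sumTo-shift f k)) (ℕ.+-assoc (f 0) _ _)

  sumTo-+ : ∀ f g k → sumTo (λ i → f i + g i) k ≡ sumTo f k + sumTo g k
  sumTo-+ f g zero    = refl
  sumTo-+ f g (suc k) = trans (cong (_+ (f (suc k) + g (suc k))) (sumTo-+ f g k))
                              (swap-middle (sumTo f k) (sumTo g k) (f (suc k)) (g (suc k)))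
    where
    swap-middle : ∀ a b c d → a + b + (c + d) ≡ a + c + (b + d)
    swap-middle = solve-∀

  sumTo-*ˡ : ∀ c f k → sumTo (λ i → c * f i) k ≡ c * sumTo f k
  sumTo-*ˡ c f zero    = refl
  sumTo-*ˡ c f (suc k) = trans (cong (_+ c * f (suc k)) (sumTo-*ˡ c f k)) (sym (ℕ.*-distribˡ-+ c (sumTo f k) (f (suc k))))

  sumTo-0 : ∀ k → sumTo (λ _ → 0) k ≡ 0
  sumTo-0 zero    = refl
  sumTo-0 (suc k) = cong (_+ 0) (sumTo-0 k)

  gauss-< : ∀ {n k} → n < k → gauss q n k ≡ 0
  gauss-< {zero}  {suc k} _ = refl
  gauss-< {suc n} {suc k} (s≤s n<k) rewrite gauss-< n<k | gauss-< (ℕ.m≤n⇒m≤1+n n<k) = ℕ.*-zeroʳ (q ^ suc k)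

  term : ℕ → ℕ → ℕ → ℕ → ℕ
  term s n k i = q ^ ((s + 1) * (k ∸ i)) * gauss q (s + i) i * gauss q (n ∸ i) (k ∸ i)

  -- What the second summand of q-Pascal's rule, applied to the middle factor, adds to term s (suc n) (suc k) (suc i).
  extra : ℕ → ℕ → ℕ → ℕ → ℕ
  extra s n k i = q ^ ((s + 1) * (k ∸ i)) * (q ^ suc i * gauss q (s + i) (suc i)) * gauss q (n ∸ i) (k ∸ i)

  term-pascal : ∀ s n k i → term s (suc n) (suc k) (suc i) ≡ term s n k i + extra s n k i
  term-pascal s n k i rewrite ℕ.+-suc s i =
    distrib (q ^ ((s + 1) * (k ∸ i))) (gauss q (s + i) i) (q ^ suc i * gauss q (s + i) (suc i)) (gauss q (n ∸ i) (k ∸ i))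
    where
    distrib : ∀ a b c d → a * (b + c) * d ≡ a * b * d + a * c * d
    distrib = solve-∀

  term-head : ∀ s n k → term (suc s) n (suc k) 0 ≡ q ^ suc k * term s n (suc k) 0
  term-head s n k = trans (cong (λ w → w * 1 * G) (ℕ.^-distribˡ-+-* q (suc k) E)) (rearrange (q ^ suc k) (q ^ E) G)
    where
    E = (s + 1) * suc k
    G = gauss q n (suc k)
    rearrange : ∀ a b g → a * b * 1 * g ≡ a * (b * 1 * g)
    rearrange = solve-∀

  extra-suc : ∀ s n k i → i ≤ k → extra (suc s) n k i ≡ q ^ suc k * term s (suc n) (suc k) (suc i)
  extra-suc s n k i i≤k = begin
    q ^ (d + E) * (q ^ suc i * g) * G     ≡⟨ cong (λ w → w * (q ^ suc i * g) * G) (ℕ.^-distribˡ-+-* q d E) ⟩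
    q ^ d * q ^ E * (q ^ suc i * g) * G   ≡⟨ rearrange (q ^ d) (q ^ E) (q ^ suc i) g G ⟩
    q ^ d * q ^ suc i * (q ^ E * g * G)   ≡⟨ cong (_* (q ^ E * g * G)) (sym (ℕ.^-distribˡ-+-* q d (suc i))) ⟩
    q ^ (d + suc i) * (q ^ E * g * G)
      ≡⟨ cong₂ (λ w z → q ^ w * (q ^ E * gauss q z (suc i) * G)) d+1+i≡1+k (sym (ℕ.+-suc s i)) ⟩
    q ^ suc k * term s (suc n) (suc k) (suc i) ∎
    where
    open ≡-Reasoning
    d = k ∸ i
    E = (s + 1) * d
    g = gauss q (suc (s + i)) (suc i)
    G = gauss q (n ∸ i) (k ∸ i)
    d+1+i≡1+k : d + suc i ≡ suc k
    d+1+i≡1+k = trans (ℕ.+-suc d i) (cong suc (ℕ.m∸n+n≡m i≤k))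
    rearrange : ∀ a b c x y → a * b * (c * x) * y ≡ a * c * (b * x * y)
    rearrange = solve-∀

  mutual
    sumTo-term≡gauss : ∀ s {n k} → k ≤ n → sumTo (term s n k) k ≡ gauss q (suc (s + n)) k
    sumTo-term≡gauss s {n} {zero} _ = cong (λ w → q ^ w * 1 * 1) (ℕ.*-zeroʳ (s + 1))
    sumTo-term≡gauss s {suc n} {suc k} (s≤s k≤n) = begin
      sumTo (term s (suc n) (suc k)) (suc k)
        ≡⟨ sumTo-shift _ k ⟩
      t₀ + sumTo (λ i → term s (suc n) (suc k) (suc i)) k
        ≡⟨ cong (t₀ +_) (trans (sumTo-cong k (λ i _ → term-pascal s n k i)) (sumTo-+ (term s n k) (extra s n k) k)) ⟩
      t₀ + (sumTo (term s n k) k + sumTo (extra s n k) k)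
        ≡⟨ cong (λ w → t₀ + (w + sumTo (extra s n k) k)) (sumTo-term≡gauss s k≤n) ⟩
      t₀ + (gauss q (suc (s + n)) k + sumTo (extra s n k) k)
        ≡⟨ swap-front t₀ (gauss q (suc (s + n)) k) (sumTo (extra s n k) k) ⟩
      gauss q (suc (s + n)) k + (t₀ + sumTo (extra s n k) k)
        ≡⟨ cong₂ _+_ (cong (λ w → gauss q w k) (sym (ℕ.+-suc s n))) (head+extras s k≤n) ⟩
      gauss q (s + suc n) k + q ^ suc k * gauss q (s + suc n) (suc k) ∎
      where
      open ≡-Reasoning
      t₀ = term s (suc n) (suc k) 0
      swap-front : ∀ a b c → a + (b + c) ≡ b + (a + c)
      swap-front = solve-∀
    sumTo-term≡gauss s {zero} {suc k} ()

    head+extras : ∀ s {n k} → k ≤ n → term s (suc n) (suc k) 0 + sumTo (extra s n k) k ≡ q ^ suc k * gauss q (s + suc n) (suc k)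
    head+extras zero {n} {k} _ = begin
      term 0 (suc n) (suc k) 0 + sumTo (extra 0 n k) k
        ≡⟨ cong₂ _+_ first-term (trans (sumTo-cong k (λ i _ → extra-vanishes i)) (sumTo-0 k)) ⟩
      q ^ suc k * gauss q (suc n) (suc k) + 0
        ≡⟨ ℕ.+-identityʳ _ ⟩
      q ^ suc k * gauss q (suc n) (suc k) ∎
      where
      open ≡-Reasoning
      first-term : term 0 (suc n) (suc k) 0 ≡ q ^ suc k * gauss q (suc n) (suc k)
      first-term = cong (_* gauss q (suc n) (suc k)) (trans (ℕ.*-identityʳ _) (cong (q ^_) (ℕ.+-identityʳ (suc k))))
      extra-vanishes : ∀ i → extra 0 n k i ≡ 0
      extra-vanishes i rewrite gauss-< (ℕ.n<1+n i) | ℕ.*-zeroʳ (q ^ suc i) | ℕ.*-zeroʳ (q ^ ((0 + 1) * (k ∸ i))) = refl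
    head+extras (suc s) {n} {k} k≤n = begin
      term (suc s) (suc n) (suc k) 0 + sumTo (extra (suc s) n k) k
        ≡⟨ cong₂ _+_ (term-head s (suc n) k) (sumTo-cong k (extra-suc s n k)) ⟩
      q ^ suc k * T 0 + sumTo (λ i → q ^ suc k * T (suc i)) k
        ≡⟨ cong (q ^ suc k * T 0 +_) (sumTo-*ˡ (q ^ suc k) (λ i → T (suc i)) k) ⟩
      q ^ suc k * T 0 + q ^ suc k * sumTo (λ i → T (suc i)) k
        ≡⟨ sym (ℕ.*-distribˡ-+ (q ^ suc k) (T 0) _) ⟩
      q ^ suc k * (T 0 + sumTo (λ i → T (suc i)) k)
        ≡⟨ cong (q ^ suc k *_) (sym (sumTo-shift T k)) ⟩
      q ^ suc k * sumTo T (suc k)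
        ≡⟨ cong (q ^ suc k *_) (sumTo-term≡gauss s (s≤s k≤n)) ⟩
      q ^ suc k * gauss q (suc s + suc n) (suc k) ∎
      where
      open ≡-Reasoning
      T = term s (suc n) (suc k)

  gauss-decomposition : ∀ {v k} s → s + k < v →
    gauss q v k ≡ sumTo (λ i → q ^ ((s + 1) * (k ∸ i)) * gauss q (s + i) i * gauss q (v ∸ s ∸ i ∸ 1) (k ∸ i)) k
  gauss-decomposition {v} {k} s s+k<v with ℕ.m≤n⇒∃[o]m+o≡n (ℕ.m+n≤o⇒m≤o (suc s) s+k<v)
  ... | n , refl = sym (trans (sumTo-cong k (λ i _ → cong (λ w → front i * gauss q w (k ∸ i)) (drop-s i)))
                             (sumTo-term≡gauss s (ℕ.+-cancelˡ-≤ (suc s) k n s+k<v)))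
    where
    front : ℕ → ℕ
    front i = q ^ ((s + 1) * (k ∸ i)) * gauss q (s + i) i
    drop-s : ∀ i → suc s + n ∸ s ∸ i ∸ 1 ≡ n ∸ i
    drop-s i = begin
      suc s + n ∸ s ∸ i ∸ 1   ≡⟨ cong (λ w → w ∸ i ∸ 1) (trans (cong (_∸ s) (sym (ℕ.+-suc s n))) (ℕ.m+n∸m≡n s (suc n))) ⟩
      suc n ∸ i ∸ 1           ≡⟨ ℕ.∸-+-assoc (suc n) i 1 ⟩
      suc n ∸ (i + 1)         ≡⟨ cong (suc n ∸_) (ℕ.+-comm i 1) ⟩
      n ∸ i                   ∎
      where open ≡-Reasoning

module LinearAlgebra {q : ℕ} (F : FiniteField q) where
  open FiniteField F using (Carrier; 0#; 1#; 0≢1; inverse; enum; isCommutativeRing)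
    renaming (_+_ to _+ᶠ_; _*_ to _*ᶠ_; -_ to -ᶠ_)
  open Lin F

  commutativeRing : CommutativeRing 0ℓ 0ℓ
  commutativeRing = record { isCommutativeRing = isCommutativeRing }

  open IsCommutativeRing isCommutativeRing using (*-comm; zeroˡ; zeroʳ; *-identityˡ; *-identityʳ; +-identityʳ)
    renaming (+-assoc to +ᶠ-assoc; +-comm to +ᶠ-comm; +-identityˡ to +ᶠ-identityˡ; -‿inverseʳ to -ᶠ‿inverseʳ)
  open import Algebra.Properties.Ring (CommutativeRing.ring commutativeRing) using (-1*x≈-x)
  open import Algebra.Solver.Ring.NaturalCoefficients (CommutativeRing.commutativeSemiring commutativeRing)
    (λ _ _ → nothing) using (solve; _:+_; _:*_; _:=_)

  _≟ᶠ_ : DecidableEquality Carrier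
  _≟ᶠ_ = via-injection (↔⇒↣ (↔-sym enum)) Fin._≟_

  ∃ᶠ? : {P : Carrier → Set} → Decidable P → Dec (∃ P)
  ∃ᶠ? {P} P? = Dec.map equivalence (Fin.any? λ i → P? (to i))
    where
    open Inverse enum using (to; from; strictlyInverseˡ)
    equivalence : ∃ (λ i → P (to i)) ⇔ ∃ P
    equivalence = mk⇔ (λ (i , p) → to i , p) (λ (x , p) → from x , subst P (sym (strictlyInverseˡ x)) p)

  ∃ᵛ? : ∀ {d} {P : Vec Carrier d → Set} → Decidable P → Dec (∃ P)
  ∃ᵛ? {zero}  {P} P? = Dec.map (mk⇔ (λ p → [] , p) λ { ([] , p) → p }) (P? [])
  ∃ᵛ? {suc d} {P} P? =
    Dec.map (mk⇔ (λ (x , c , p) → x ∷ c , p) λ { (x ∷ c , p) → x , c , p })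
            (∃ᶠ? λ x → ∃ᵛ? λ c → P? (x ∷ c))

  x+-1*x≡0 : ∀ x → x +ᶠ ((-ᶠ 1#) *ᶠ x) ≡ 0#
  x+-1*x≡0 x = trans (cong (x +ᶠ_) (-1*x≈-x x)) (-ᶠ‿inverseʳ x)

  ⊝_ : ∀ {n} → Vect n → Vect n
  ⊝ x = (-ᶠ 1#) · x

  +ᵛ-isAbelianGroup : ∀ n → IsAbelianGroup _≡_ (_⊕_ {n}) 𝟎 ⊝_
  +ᵛ-isAbelianGroup n = record
    { isGroup = record
      { isMonoid = record
        { isSemigroup = record
          { isMagma = record { isEquivalence = isEquivalence ; ∙-cong = cong₂ _⊕_ }
          ; assoc = Vec.zipWith-assoc +ᶠ-assoc }
        ; identity = Vec.zipWith-identityˡ +ᶠ-identityˡ , Vec.zipWith-identityʳ +-identityʳ }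
      ; inverse = Vec.zipWith-inverseˡ (λ x → trans (+ᶠ-comm _ x) (x+-1*x≡0 x))
                , Vec.zipWith-inverseʳ x+-1*x≡0
      ; ⁻¹-cong = cong ⊝_ }
    ; comm = Vec.zipWith-comm +ᶠ-comm }

  +ᵛ-abelianGroup : ℕ → AbelianGroup 0ℓ 0ℓ
  +ᵛ-abelianGroup n = record { isAbelianGroup = +ᵛ-isAbelianGroup n }

  private
    module G {n} = AbelianGroup (+ᵛ-abelianGroup n)
    module GP {n} = Algebra.Properties.AbelianGroup (+ᵛ-abelianGroup n)
    module CS {n} = Algebra.Properties.CommutativeSemigroup (AbelianGroup.commutativeSemigroup (+ᵛ-abelianGroup n))

  ·-distribˡ-⊕ : ∀ {n} c (x y : Vect n) → c · (x ⊕ y) ≡ (c · x) ⊕ (c · y)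
  ·-distribˡ-⊕ c [] [] = refl
  ·-distribˡ-⊕ c (a ∷ x) (b ∷ y) =
    cong₂ _∷_ (solve 3 (λ c a b → c :* (a :+ b) := c :* a :+ c :* b) refl c a b) (·-distribˡ-⊕ c x y)

  ·-distribʳ-+ : ∀ {n} a b (x : Vect n) → (a +ᶠ b) · x ≡ (a · x) ⊕ (b · x)
  ·-distribʳ-+ a b [] = refl
  ·-distribʳ-+ a b (c ∷ x) =
    cong₂ _∷_ (solve 3 (λ a b c → (a :+ b) :* c := a :* c :+ b :* c) refl a b c) (·-distribʳ-+ a b x)

  *-· : ∀ {n} a b (x : Vect n) → (a *ᶠ b) · x ≡ a · (b · x)
  *-· a b [] = refl
  *-· a b (c ∷ x) = cong₂ _∷_ (solve 3 (λ a b c → (a :* b) :* c := a :* (b :* c)) refl a b c) (*-· a b x)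

  ·-comm : ∀ {n} a b (x : Vect n) → a · (b · x) ≡ b · (a · x)
  ·-comm a b x = trans (sym (*-· a b x)) (trans (cong (_· x) (*-comm a b)) (*-· b a x))

  1·x≡x : ∀ {n} (x : Vect n) → 1# · x ≡ x
  1·x≡x [] = refl
  1·x≡x (a ∷ x) = cong₂ _∷_ (*-identityˡ a) (1·x≡x x)

  0·x≡𝟎 : ∀ {n} (x : Vect n) → 0# · x ≡ 𝟎
  0·x≡𝟎 [] = refl
  0·x≡𝟎 (a ∷ x) = cong₂ _∷_ (zeroˡ a) (0·x≡𝟎 x)

  ·𝟎≡𝟎 : ∀ {n} c → c · 𝟎 {n} ≡ 𝟎
  ·𝟎≡𝟎 {zero} c = refl
  ·𝟎≡𝟎 {suc n} c = cong₂ _∷_ (zeroʳ c) (·𝟎≡𝟎 c)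

  ·-cancel : ∀ {n} {c e} (x : Vect n) → c *ᶠ e ≡ 1# → e · (c · x) ≡ x
  ·-cancel {c = c} {e} x ce≡1 = trans (sym (*-· e c x)) (trans (cong (_· x) (trans (*-comm e c) ce≡1)) (1·x≡x x))

  ·-distribˡ-⊖ : ∀ {n} c (x y : Vect n) → c · (x ⊖ y) ≡ (c · x) ⊖ (c · y)
  ·-distribˡ-⊖ c x y = trans (·-distribˡ-⊕ c x (⊝ y)) (cong ((c · x) ⊕_) (·-comm c (-ᶠ 1#) y))

  ⊖-interchange : ∀ {n} (x y x′ y′ : Vect n) → (x ⊕ y) ⊖ (x′ ⊕ y′) ≡ (x ⊖ x′) ⊕ (y ⊖ y′)
  ⊖-interchange x y x′ y′ =
    trans (cong ((x ⊕ y) ⊕_) (sym (GP.⁻¹-∙-comm x′ y′))) (CS.interchange x y (⊝ x′) (⊝ y′))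

  ⊖-cancel : ∀ {n} (x y z : Vect n) → (x ⊖ y) ⊕ (y ⊖ z) ≡ x ⊖ z
  ⊖-cancel x y z = trans (sym (G.assoc (x ⊖ y) y (⊝ z))) (cong (_⊕ ⊝ z) (GP.//-rightDividesˡ y x))

  infix 4 _∼[_]_
  _∼[_]_ : ∀ {v} → Vect v → Subspace v → Vect v → Set
  x ∼[ Z ] y = mem Z (x ⊖ y)

  module _ {v} (Z : Subspace v) where

    ⊖-∈ : ∀ {x y} → mem Z x → mem Z y → mem Z (x ⊖ y)
    ⊖-∈ x∈ y∈ = +∈ Z x∈ (·∈ Z _ y∈)

    ∼-reflexive : ∀ {x y} → x ≡ y → x ∼[ Z ] y
    ∼-reflexive {x} refl = subst (mem Z) (sym (G.inverseʳ x)) (0∈ Z)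

    ∼-trans : ∀ {x y z} → x ∼[ Z ] y → y ∼[ Z ] z → x ∼[ Z ] z
    ∼-trans {x} {y} {z} x∼y y∼z = subst (mem Z) (⊖-cancel x y z) (+∈ Z x∼y y∼z)

    ⊕-cong : ∀ {x y x′ y′} → x ∼[ Z ] x′ → y ∼[ Z ] y′ → x ⊕ y ∼[ Z ] x′ ⊕ y′
    ⊕-cong {x} {y} {x′} {y′} p r = subst (mem Z) (sym (⊖-interchange x y x′ y′)) (+∈ Z p r)

    ·-cong : ∀ c {x y} → x ∼[ Z ] y → c · x ∼[ Z ] c · y
    ·-cong c {x} {y} p = subst (mem Z) (·-distribˡ-⊖ c x y) (·∈ Z c p)

    ∼𝟎⇒∈ : ∀ {x} → x ∼[ Z ] 𝟎 → mem Z x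
    ∼𝟎⇒∈ {x} = subst (mem Z) (trans (cong (x ⊕_) GP.ε⁻¹≈ε) (G.identityʳ x))

    ∈⇒∼𝟎 : ∀ {x} → mem Z x → x ∼[ Z ] 𝟎
    ∈⇒∼𝟎 {x} = subst (mem Z) (sym (trans (cong (x ⊕_) GP.ε⁻¹≈ε) (G.identityʳ x)))

  ZeroSubspace : ∀ {v} → Subspace v
  ZeroSubspace = record
    { mem = IsZero
    ; 0∈ = refl
    ; +∈ = λ { refl refl → G.identityˡ 𝟎 }
    ; ·∈ = λ { c refl → ·𝟎≡𝟎 c } }

  ∼[0]⇒≡ : ∀ {v} {x y : Vect v} → x ∼[ ZeroSubspace ] y → x ≡ y
  ∼[0]⇒≡ {x = x} {y} = GP.x∙y⁻¹≈ε⇒x≈y x y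

  _∩ˢ_ : ∀ {v} → Subspace v → Subspace v → Subspace v
  U ∩ˢ W = record
    { mem = λ x → mem U x × mem W x
    ; 0∈ = 0∈ U , 0∈ W
    ; +∈ = λ (p , p′) (r , r′) → +∈ U p r , +∈ W p′ r′
    ; ·∈ = λ c (p , p′) → ·∈ U c p , ·∈ W c p′ }

  _+ˢ_ : ∀ {v} → Subspace v → Subspace v → Subspace v
  _+ˢ_ {v} U W = record
    { mem = λ x → Σ (Vect v) λ a → Σ (Vect v) λ b → mem U a × mem W b × x ≡ a ⊕ b
    ; 0∈ = 𝟎 , 𝟎 , 0∈ U , 0∈ W , sym (G.identityˡ 𝟎)
    ; +∈ = λ { (a , b , a∈ , b∈ , refl) (a′ , b′ , a′∈ , b′∈ , refl) →
               a ⊕ a′ , b ⊕ b′ , +∈ U a∈ a′∈ , +∈ W b∈ b′∈ , CS.interchange a b a′ b′ }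
    ; ·∈ = λ { c (a , b , a∈ , b∈ , refl) → c · a , c · b , ·∈ U c a∈ , ·∈ W c b∈ , ·-distribˡ-⊕ c a b } }

  lincomb-𝟎ˡ : ∀ {v d} (b : Vec (Vect v) d) → lincomb 𝟎 b ≡ 𝟎
  lincomb-𝟎ˡ [] = refl
  lincomb-𝟎ˡ (b ∷ bs) = trans (cong₂ _⊕_ (0·x≡𝟎 b) (lincomb-𝟎ˡ bs)) (G.identityˡ 𝟎)

  lincomb-⊕ˡ : ∀ {v d} (c c′ : Vec Carrier d) (b : Vec (Vect v) d) →
               lincomb (c ⊕ c′) b ≡ lincomb c b ⊕ lincomb c′ b
  lincomb-⊕ˡ [] [] [] = sym (G.identityˡ 𝟎)
  lincomb-⊕ˡ (x ∷ c) (y ∷ c′) (b ∷ bs) =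
    trans (cong₂ _⊕_ (·-distribʳ-+ x y b) (lincomb-⊕ˡ c c′ bs)) (CS.interchange _ _ _ _)

  lincomb-·ˡ : ∀ {v d} a (c : Vec Carrier d) (b : Vec (Vect v) d) → lincomb (a · c) b ≡ a · lincomb c b
  lincomb-·ˡ a [] [] = sym (·𝟎≡𝟎 a)
  lincomb-·ˡ a (x ∷ c) (b ∷ bs) = trans (cong₂ _⊕_ (*-· a x b) (lincomb-·ˡ a c bs)) (sym (·-distribˡ-⊕ a _ _))

  lincomb-++ : ∀ {v d e} (c₁ : Vec Carrier d) (c₂ : Vec Carrier e) (a : Vec (Vect v) d) (b : Vec (Vect v) e) →
               lincomb (c₁ ++ c₂) (a ++ b) ≡ lincomb c₁ a ⊕ lincomb c₂ b
  lincomb-++ [] c₂ [] b = sym (G.identityˡ _)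
  lincomb-++ (x ∷ c₁) c₂ (a ∷ as) b = trans (cong ((x · a) ⊕_) (lincomb-++ c₁ c₂ as b)) (sym (G.assoc _ _ _))

  lincomb-insertAt : ∀ {v d} (c : Vec Carrier d) (b : Vec (Vect v) d) t x y →
                     lincomb (insertAt c t x) (insertAt b t y) ≡ (x · y) ⊕ lincomb c b
  lincomb-insertAt c b zero x y = refl
  lincomb-insertAt (c₀ ∷ c) (b₀ ∷ b) (suc t) x y =
    trans (cong ((c₀ · b₀) ⊕_) (lincomb-insertAt c b t x y)) (CS.x∙yz≈y∙xz _ _ _)

  lincomb-lincomb : ∀ {v n m} (c : Vec Carrier m) (M : Vec (Vec Carrier n) m) (b : Vec (Vect v) n) →
                    lincomb c (map (λ μ → lincomb μ b) M) ≡ lincomb (lincomb c M) b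
  lincomb-lincomb [] [] b = sym (lincomb-𝟎ˡ b)
  lincomb-lincomb (x ∷ c) (μ ∷ M) b = begin
    (x · lincomb μ b) ⊕ lincomb c (map (λ μ → lincomb μ b) M) ≡⟨ cong₂ _⊕_ (sym (lincomb-·ˡ x μ b)) (lincomb-lincomb c M b) ⟩
    lincomb (x · μ) b ⊕ lincomb (lincomb c M) b               ≡⟨ sym (lincomb-⊕ˡ (x · μ) (lincomb c M) b) ⟩
    lincomb ((x · μ) ⊕ lincomb c M) b                         ∎
    where open ≡-Reasoning

  lincomb-∈ : ∀ {v d} (Z : Subspace v) (c : Vec Carrier d) {b : Vec (Vect v) d} → All (mem Z) b → mem Z (lincomb c b)
  lincomb-∈ Z [] [] = 0∈ Z
  lincomb-∈ Z (x ∷ c) (p ∷ ps) = +∈ Z (·∈ Z x p) (lincomb-∈ Z c ps)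

  lincomb-cong : ∀ {v d} (Z : Subspace v) (c : Vec Carrier d) {a b : Vec (Vect v) d} →
                 Pointwise _∼[ Z ]_ a b → lincomb c a ∼[ Z ] lincomb c b
  lincomb-cong Z [] [] = ∼-reflexive Z refl
  lincomb-cong Z (x ∷ c) (p ∷ ps) = ⊕-cong Z (·-cong Z x p) (lincomb-cong Z c ps)

  InSpan : ∀ {v d} → Subspace v → Vec (Vect v) d → Vect v → Set
  InSpan Z b x = ∃ λ c → x ∼[ Z ] lincomb c b

  Independent : ∀ {v d} → Subspace v → Vec (Vect v) d → Set
  Independent Z b = ∀ c → mem Z (lincomb c b) → c ≡ 𝟎

  []-independent : ∀ {v} (Z : Subspace v) → Independent Z []
  []-independent Z [] _ = refl

  ∷-independent : ∀ {v d} (Z : Subspace v) {y} {a : Vec (Vect v) d} →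
                  Independent Z a → ¬ InSpan Z a y → Independent Z (y ∷ a)
  ∷-independent Z {y} {a} ind y∉ (c₀ ∷ cs) z with c₀ ≟ᶠ 0#
  ... | yes refl = cong (0# ∷_) (ind cs (subst (mem Z) (trans (cong (_⊕ lincomb cs a) (0·x≡𝟎 y)) (G.identityˡ _)) z))
  ... | no c₀≢0 with inverse c₀ c₀≢0
  ... | e , c₀e≡1 = contradiction (((-ᶠ 1#) *ᶠ e) · cs , subst (mem Z) eq (·∈ Z e z)) y∉
    where
    L = lincomb cs a
    eq : e · ((c₀ · y) ⊕ L) ≡ y ⊖ lincomb (((-ᶠ 1#) *ᶠ e) · cs) a
    eq = begin
      e · ((c₀ · y) ⊕ L)                    ≡⟨ ·-distribˡ-⊕ e _ L ⟩
      (e · (c₀ · y)) ⊕ (e · L)              ≡⟨ cong₂ _⊕_ (·-cancel y c₀e≡1) (sym (GP.⁻¹-involutive (e · L))) ⟩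
      y ⊖ (⊝ (e · L))                       ≡⟨ cong (λ w → y ⊖ w) (sym (*-· (-ᶠ 1#) e L)) ⟩
      y ⊖ (((-ᶠ 1#) *ᶠ e) · L)              ≡⟨ cong (λ w → y ⊖ w) (sym (lincomb-·ˡ _ cs a)) ⟩
      y ⊖ lincomb (((-ᶠ 1#) *ᶠ e) · cs) a   ∎
      where open ≡-Reasoning

  -- Gaussian elimination

  dot : ∀ {m} → Vec Carrier m → Vec Carrier m → Carrier
  dot [] [] = 0#
  dot (c ∷ cs) (h ∷ hs) = (c *ᶠ h) +ᶠ dot cs hs

  lincomb-∷ : ∀ {n m} (c : Vec Carrier m) (Ms : Vec (Vect (suc n)) m) →
              lincomb c Ms ≡ dot c (map head Ms) ∷ lincomb c (map tail Ms)
  lincomb-∷ [] [] = refl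
  lincomb-∷ (c ∷ cs) ((h ∷ T) ∷ Ms) = cong (((c *ᶠ h) ∷ (c · T)) ⊕_) (lincomb-∷ cs Ms)

  dot-𝟎ʳ : ∀ {m} (c : Vec Carrier m) {hs} → All (_≡ 0#) hs → dot c hs ≡ 0#
  dot-𝟎ʳ [] [] = refl
  dot-𝟎ʳ (c ∷ cs) (refl ∷ ps) = trans (cong₂ _+ᶠ_ (zeroʳ c) (dot-𝟎ʳ cs ps)) (+-identityʳ 0#)

  lincomb-clear : ∀ {n m} (f : Vect n → Carrier) (P : Vect n) (c : Vec Carrier m) (R : Vec (Vect n) m) →
                  lincomb c (map (λ M → M ⊖ (f M · P)) R) ≡ lincomb c R ⊖ (dot c (map f R) · P)
  lincomb-clear f P [] [] =
    sym (trans (cong (λ w → 𝟎 ⊖ w) (0·x≡𝟎 P)) (G.inverseʳ 𝟎))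
  lincomb-clear f P (c ∷ cs) (M ∷ R) = begin
    (c · (M ⊖ (f M · P))) ⊕ lincomb cs (map (λ M → M ⊖ (f M · P)) R)
      ≡⟨ cong₂ _⊕_ (·-distribˡ-⊖ c M _) (lincomb-clear f P cs R) ⟩
    ((c · M) ⊖ (c · (f M · P))) ⊕ (lincomb cs R ⊖ (α · P))
      ≡⟨ sym (⊖-interchange _ _ _ _) ⟩
    ((c · M) ⊕ lincomb cs R) ⊖ ((c · (f M · P)) ⊕ (α · P))
      ≡⟨ cong (λ w → ((c · M) ⊕ lincomb cs R) ⊖ (w ⊕ (α · P))) (sym (*-· c (f M) P)) ⟩
    ((c · M) ⊕ lincomb cs R) ⊖ (((c *ᶠ f M) · P) ⊕ (α · P))
      ≡⟨ cong (λ w → ((c · M) ⊕ lincomb cs R) ⊖ w) (sym (·-distribʳ-+ (c *ᶠ f M) α P)) ⟩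
    ((c · M) ⊕ lincomb cs R) ⊖ (((c *ᶠ f M) +ᶠ α) · P) ∎
    where
    open ≡-Reasoning
    α = dot cs (map f R)

  pivot? : ∀ {n m} (Ms : Vec (Vect (suc n)) m) → All (λ M → head M ≡ 0#) Ms ⊎ ∃ λ t → head (lookup Ms t) ≢ 0#
  pivot? [] = inj₁ []
  pivot? (M ∷ Ms) with head M ≟ᶠ 0# | pivot? Ms
  ... | no h≢0  | _               = inj₂ (zero , h≢0)
  ... | yes h≡0 | inj₁ hs         = inj₁ (h≡0 ∷ hs)
  ... | yes _   | inj₂ (t , h≢0)  = inj₂ (suc t , h≢0)

  clear-head : ∀ {n} (M Q : Vect (suc n)) {r} → head Q *ᶠ r ≡ 1# → head (M ⊖ ((head M *ᶠ r) · Q)) ≡ 0#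
  clear-head (h ∷ _) (p ∷ _) {r} pr≡1 = trans (cong (λ w → h +ᶠ ((-ᶠ 1#) *ᶠ w)) hrp≡h) (x+-1*x≡0 h)
    where
    hrp≡h : (h *ᶠ r) *ᶠ p ≡ h
    hrp≡h = trans (solve 3 (λ h r p → (h :* r) :* p := h :* (p :* r)) refl h r p) (trans (cong (h *ᶠ_) pr≡1) (*-identityʳ h))

  removeAt-𝟎 : ∀ {m} (t : Fin (suc m)) → removeAt (𝟎 {suc m}) t ≡ 𝟎
  removeAt-𝟎 zero = refl
  removeAt-𝟎 {suc m} (suc t) = cong (0# ∷_) (removeAt-𝟎 t)

  Dependent : ∀ {n m} → Vec (Vect n) m → Set
  Dependent Ms = ∃ λ c → c ≢ 𝟎 × lincomb c Ms ≡ 𝟎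

  heads-zero-dependent : ∀ {n m} (Ms : Vec (Vect (suc n)) m) → All (λ M → head M ≡ 0#) Ms →
                         Dependent (map tail Ms) → Dependent Ms
  heads-zero-dependent Ms heads≡0 (c , c≢𝟎 , tails≡𝟎) =
    c , c≢𝟎 , trans (lincomb-∷ c Ms) (cong₂ _∷_ (dot-𝟎ʳ c (All.map⁺ heads≡0)) tails≡𝟎)

  -- One step of Gaussian elimination: clear the first coordinate using the pivot, drop the pivot.
  pivot-dependent : ∀ {n m} (Ms : Vec (Vect (suc n)) (suc m)) t → head (lookup Ms t) ≢ 0# →
                    (∀ (Ns : Vec (Vect n) m) → Dependent Ns) → Dependent Ms
  pivot-dependent Ms t p≢0 dependent with inverse (head (lookup Ms t)) p≢0
  ... | p⁻¹ , pp⁻¹≡1 =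
    reinsert-pivot (heads-zero-dependent R′ (All.map⁺ (All.universal cleared R)) (dependent (map tail R′)))
    where
    P = lookup Ms t
    R = removeAt Ms t
    f : Vect _ → Carrier
    f M = head M *ᶠ p⁻¹
    R′ = map (λ M → M ⊖ (f M · P)) R
    cleared : ∀ M → head (M ⊖ (f M · P)) ≡ 0#
    cleared M = clear-head M P pp⁻¹≡1
    reinsert-pivot : Dependent R′ → Dependent Ms
    reinsert-pivot (c′ , c′≢𝟎 , R′-lincomb≡𝟎) = c , c≢𝟎 , lincomb≡𝟎
      where
      α = dot c′ (map f R)
      c = insertAt c′ t ((-ᶠ 1#) *ᶠ α)
      c≢𝟎 : c ≢ 𝟎
      c≢𝟎 e = c′≢𝟎 (trans (sym (Vec.removeAt-insertAt c′ t _)) (trans (cong (λ z → removeAt z t) e) (removeAt-𝟎 t)))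
      lincomb≡𝟎 : lincomb c Ms ≡ 𝟎
      lincomb≡𝟎 = begin
        lincomb c Ms                          ≡⟨ cong (lincomb c) (sym (Vec.insertAt-removeAt Ms t)) ⟩
        lincomb c (insertAt R t P)            ≡⟨ lincomb-insertAt c′ R t _ P ⟩
        (((-ᶠ 1#) *ᶠ α) · P) ⊕ lincomb c′ R   ≡⟨ trans (G.comm _ _) (cong (lincomb c′ R ⊕_) (*-· (-ᶠ 1#) α P)) ⟩
        lincomb c′ R ⊖ (α · P)                ≡⟨ sym (lincomb-clear f P c′ R) ⟩
        lincomb c′ R′                         ≡⟨ R′-lincomb≡𝟎 ⟩
        𝟎                                     ∎
        where open ≡-Reasoning

  n<m⇒dependent : ∀ {n m} → n < m → (Ms : Vec (Vect n) m) → Dependent Ms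
  n<m⇒dependent {zero} {suc m} _ Ms = 1# ∷ 𝟎 , (λ e → 0≢1 (sym (cong head e))) , vect0≡𝟎 _
    where
    vect0≡𝟎 : (x : Vect 0) → x ≡ 𝟎
    vect0≡𝟎 [] = refl
  n<m⇒dependent {suc n} n<m Ms with pivot? Ms
  ... | inj₁ heads≡0 = heads-zero-dependent Ms heads≡0 (n<m⇒dependent (ℕ.<-trans (ℕ.n<1+n n) n<m) (map tail Ms))
  n<m⇒dependent {suc n} {suc m} (s≤s n<m) Ms | inj₂ (t , p≢0) = pivot-dependent Ms t p≢0 (n<m⇒dependent n<m)

  -- Steinitz exchange and existence of bases

  coefficients : ∀ {v n m} (Z : Subspace v) (b : Vec (Vect v) n) {a : Vec (Vect v) m} → All (InSpan Z b) a →
                 Σ (Vec (Vec Carrier n) m) λ M → Pointwise _∼[ Z ]_ a (map (λ μ → lincomb μ b) M)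
  coefficients Z b [] = [] , []
  coefficients Z b ((μ , p) ∷ ps) with coefficients Z b ps
  ... | M , qs = μ ∷ M , p ∷ qs

  steinitz : ∀ {v n m} (Z : Subspace v) {a : Vec (Vect v) m} (b : Vec (Vect v) n) →
             Independent Z a → All (InSpan Z b) a → m ≤ n
  steinitz {m = m} Z {a} b ind a∈span with m ≤? _
  ... | yes m≤n = m≤n
  ... | no m≰n with coefficients Z b a∈span
  ... | M , a∼Mb with n<m⇒dependent (ℕ.≰⇒> m≰n) M
  ... | c , c≢𝟎 , cM≡𝟎 = contradiction (ind c (∼𝟎⇒∈ Z ca∼𝟎)) c≢𝟎
    where
    ca∼𝟎 : lincomb c a ∼[ Z ] 𝟎
    ca∼𝟎 = ∼-trans Z (lincomb-cong Z c a∼Mb)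
             (∼-reflexive Z (trans (lincomb-lincomb c M b) (trans (cong (λ w → lincomb w b) cM≡𝟎) (lincomb-𝟎ˡ b))))

  0⊆ : ∀ {v} (Z : Subspace v) → ZeroSubspace ⊆ Z
  0⊆ Z _ refl = 0∈ Z

  independent⇒length≤dim : ∀ {v d} (Z : Subspace v) {a : Vec (Vect v) d} → Independent Z a → d ≤ v
  independent⇒length≤dim {v} {d} Z {a} ind with d ≤? v
  ... | yes d≤v = d≤v
  ... | no d≰v with n<m⇒dependent (ℕ.≰⇒> d≰v) a
  ... | c , c≢𝟎 , ca≡𝟎 = contradiction (ind c (0⊆ Z _ ca≡𝟎)) c≢𝟎

  inSpan? : ∀ {v d} (Z : Subspace v) → Decidable (mem Z) → (b : Vec (Vect v) d) → Decidable (InSpan Z b)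
  inSpan? Z Z? b x = ∃ᵛ? λ c → Z? (x ⊖ lincomb c b)

  isZero? : ∀ {v} → Decidable (IsZero {v})
  isZero? x = Vec.≡-dec _≟ᶠ_ x 𝟎

  dimMod-exists : ∀ {v} (Z : Subspace v) → Decidable (mem Z) → (P : Vect v → Set) → Decidable P →
                  ∃ (DimMod (mem Z) P)
  dimMod-exists {v} Z Z? P P? = extend (suc v) [] [] ([]-independent Z) ℕ.≤-refl
    where
    extend : ∀ fuel {d} (a : Vec (Vect v) d) → All P a → Independent Z a → v < d + fuel → ∃ (DimMod (mem Z) P)
    extend zero {d} a _ ind v<d+0 =
      contradiction (independent⇒length≤dim Z ind) (ℕ.<⇒≱ (subst (v <_) (ℕ.+-identityʳ d) v<d+0))
    extend (suc fuel) {d} a a∈P ind v<d+fuel with ∃ᵛ? (λ x → P? x ×-dec ¬? (inSpan? Z Z? a x))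
    ... | yes (x , x∈P , x∉span) =
      extend fuel (x ∷ a) (x∈P ∷ a∈P) (∷-independent Z ind x∉span) (subst (v <_) (ℕ.+-suc d fuel) v<d+fuel)
    ... | no ∄ = d , a , a∈P , ind , spans
      where
      spans : ∀ x → P x → InSpan Z a x
      spans x x∈P with inSpan? Z Z? a x
      ... | yes x∈span = x∈span
      ... | no x∉span = contradiction (x , x∈P , x∉span) ∄

  dim⇒decidable : ∀ {v d} (W : Subspace v) → Dim W d → Decidable (mem W)
  dim⇒decidable W (b , b∈W , _ , spans) x =
    Dec.map (mk⇔ (λ (c , x∼cb) → subst (mem W) (sym (∼[0]⇒≡ x∼cb)) (lincomb-∈ W c b∈W)) (spans x))
            (inSpan? ZeroSubspace isZero? b x)

  independent-in⇒≤dimMod : ∀ {v m d} (Z : Subspace v) {W : Vect v → Set} {a : Vec (Vect v) m} →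
                           Independent Z a → All W a → DimMod (mem Z) W d → m ≤ d
  independent-in⇒≤dimMod Z ind a∈W (b , _ , _ , spans) = steinitz Z b ind (All.map (λ {x} → spans x) a∈W)

  dimMod-mono : ∀ {v d₁ d₂} (Z : Subspace v) {W W′ : Vect v → Set} →
                DimMod (mem Z) W d₁ → DimMod (mem Z) W′ d₂ → (∀ x → W x → W′ x) → d₁ ≤ d₂
  dimMod-mono Z (a , a∈W , ind , _) dim′ W⊆W′ = independent-in⇒≤dimMod Z ind (All.map (λ {x} → W⊆W′ x) a∈W) dim′

  dimMod-unique : ∀ {v d₁ d₂} (Z : Subspace v) {W W′ : Vect v → Set} →
                  DimMod (mem Z) W d₁ → DimMod (mem Z) W′ d₂ → (∀ x → W x → W′ x) → (∀ x → W′ x → W x) → d₁ ≡ d₂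
  dimMod-unique Z dim dim′ W⊆W′ W′⊆W = ℕ.≤-antisym (dimMod-mono Z dim dim′ W⊆W′) (dimMod-mono Z dim′ dim W′⊆W)

  dimMod-cast : ∀ {v d} {Z : Vect v → Set} {W W′ : Vect v → Set} →
                (∀ x → W x ⇔ W′ x) → DimMod Z W d → DimMod Z W′ d
  dimMod-cast W⇔W′ (b , b∈W , ind , spans) =
    b , All.map (λ {x} → Equivalence.to (W⇔W′ x)) b∈W , ind , λ x x∈W′ → spans x (Equivalence.from (W⇔W′ x) x∈W′)

  ⊆-with-equal-dim⇒⊇ : ∀ {v d} (W : Subspace v) {W′ : Vect v → Set} → Dim W d → DimMod IsZero W′ d →
                        (∀ x → mem W x → W′ x) → ∀ x → W′ x → mem W x
  ⊆-with-equal-dim⇒⊇ W (a , a∈W , ind , _) dim′ W⊆W′ x x∈W′ with inSpan? ZeroSubspace isZero? a x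
  ... | yes (c , x∼ca) = subst (mem W) (sym (∼[0]⇒≡ x∼ca)) (lincomb-∈ W c a∈W)
  ... | no x∉span = contradiction
    (independent-in⇒≤dimMod ZeroSubspace (∷-independent ZeroSubspace ind x∉span) (x∈W′ ∷ All.map (λ {y} → W⊆W′ y) a∈W) dim′)
    (ℕ.n≮n _)

  𝟎++𝟎 : ∀ {m n} → 𝟎 {m} ++ 𝟎 {n} ≡ 𝟎
  𝟎++𝟎 {zero} = refl
  𝟎++𝟎 {suc m} = cong (0# ∷_) (𝟎++𝟎 {m})

  dimension-formula : ∀ {v i e} (Z W : Subspace v) → Dim (Z ∩ˢ W) i → DimMod (mem Z) (mem W) e → Dim W (i + e)
  dimension-formula {v} {i} {e} Z W (a , a∈Z∩W , a-ind , a-spans) (g , g∈W , g-ind , g-spans) =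
    a ++ g , All.++⁺ (All.map proj₂ a∈Z∩W) g∈W , independent , spans
    where
    independent : Independent ZeroSubspace (a ++ g)
    independent c ca+cg≡𝟎 with splitAt i c
    ... | c₁ , c₂ , refl = trans (cong₂ _++_ c₁≡𝟎 c₂≡𝟎) (𝟎++𝟎 {i})
      where
      La = lincomb c₁ a
      Lg = lincomb c₂ g
      sum≡𝟎 : La ⊕ Lg ≡ 𝟎
      sum≡𝟎 = trans (sym (lincomb-++ c₁ c₂ a g)) ca+cg≡𝟎
      Lg∈Z : mem Z Lg
      Lg∈Z = subst (mem Z) (trans (cong (λ w → w ⊖ La) (sym (trans (G.comm Lg La) sum≡𝟎))) (GP.//-rightDividesʳ La Lg))
               (⊖-∈ Z (0∈ Z) (proj₁ (lincomb-∈ (Z ∩ˢ W) c₁ a∈Z∩W)))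
      c₂≡𝟎 : c₂ ≡ 𝟎
      c₂≡𝟎 = g-ind c₂ Lg∈Z
      c₁≡𝟎 : c₁ ≡ 𝟎
      c₁≡𝟎 = a-ind c₁ (begin
        La          ≡⟨ sym (G.identityʳ La) ⟩
        La ⊕ 𝟎      ≡⟨ cong (La ⊕_) (sym (trans (cong (λ w → lincomb w g) c₂≡𝟎) (lincomb-𝟎ˡ g))) ⟩
        La ⊕ Lg     ≡⟨ sum≡𝟎 ⟩
        𝟎           ∎)
        where open ≡-Reasoning
    spans : ∀ x → mem W x → InSpan ZeroSubspace (a ++ g) x
    spans x x∈W with g-spans x x∈W
    ... | c₂ , x∼c₂g with a-spans (x ⊖ lincomb c₂ g) (x∼c₂g , ⊖-∈ W x∈W (lincomb-∈ W c₂ g∈W))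
    ... | c₁ , rest∼c₁a = c₁ ++ c₂ , ∼-reflexive ZeroSubspace (begin
      x                                ≡⟨ sym (GP.//-rightDividesˡ (lincomb c₂ g) x) ⟩
      (x ⊖ lincomb c₂ g) ⊕ lincomb c₂ g  ≡⟨ cong (_⊕ lincomb c₂ g) (∼[0]⇒≡ rest∼c₁a) ⟩
      lincomb c₁ a ⊕ lincomb c₂ g        ≡⟨ sym (lincomb-++ c₁ c₂ a g) ⟩
      lincomb (c₁ ++ c₂) (a ++ g)        ∎)
      where open ≡-Reasoning

  module _ {v} (Z W : Subspace v) where

    dimMod-+ˢ⁺ : ∀ {d} → DimMod (mem Z) (mem W) d → DimMod (mem Z) (mem (Z +ˢ W)) d
    dimMod-+ˢ⁺ (g , g∈W , ind , spans) =
      g , All.map (λ {y} y∈W → 𝟎 , y , 0∈ Z , y∈W , sym (G.identityˡ y)) g∈W , ind , spans′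
      where
      spans′ : ∀ x → mem (Z +ˢ W) x → InSpan Z g x
      spans′ _ (u , y , u∈Z , y∈W , refl) with spans y y∈W
      ... | c , y∼cg = c , ∼-trans Z (subst (mem Z) (sym (GP.//-rightDividesʳ y u)) u∈Z) y∼cg

    private
      W-components : ∀ {d} {g : Vec (Vect v) d} → All (mem (Z +ˢ W)) g →
                     Σ (Vec (Vect v) d) λ y → All (mem W) y × Pointwise _∼[ Z ]_ g y
      W-components [] = [] , [] , []
      W-components ((u , y , u∈Z , y∈W , refl) ∷ ps) with W-components ps
      ... | ys , ys∈W , g∼ys = y ∷ ys , y∈W ∷ ys∈W , subst (mem Z) (sym (GP.//-rightDividesʳ y u)) u∈Z ∷ g∼ys

    dimMod-+ˢ⁻ : ∀ {d} → DimMod (mem Z) (mem (Z +ˢ W)) d → DimMod (mem Z) (mem W) d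
    dimMod-+ˢ⁻ (g , g∈Z+W , ind , spans) with W-components g∈Z+W
    ... | y , y∈W , g∼y = y , y∈W , ind′ , spans′
      where
      ind′ : Independent Z y
      ind′ c cy∈Z = ind c (∼𝟎⇒∈ Z (∼-trans Z (lincomb-cong Z c g∼y) (∈⇒∼𝟎 Z cy∈Z)))
      spans′ : ∀ x → mem W x → InSpan Z y x
      spans′ x x∈W with spans x (𝟎 , x , 0∈ Z , x∈W , sym (G.identityˡ x))
      ... | c , x∼cg = c , ∼-trans Z x∼cg (lincomb-cong Z c g∼y)

  -- Avoiding joins

  module _ {v} (U₁ U₂ K : Subspace v) where

    avoidingJoin⇒dim : ∀ {i j} → InAvoidingJoin U₁ U₂ i j K → Dim K (i + j)
    avoidingJoin⇒dim (B₁ , K₂ , _ , dim-B₁ , _ , dimMod-K₂ , U₁∩K≐B₁ , U₂+K≐K₂ , avoids) =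
      dimension-formula U₂ K (dimMod-cast {Z = IsZero} B₁⇔U₂∩K dim-B₁)
        (dimMod-+ˢ⁻ U₂ K (dimMod-cast {Z = mem U₂} (λ x → ⇔-sym (U₂+K≐K₂ x)) dimMod-K₂))
      where
      B₁⇔U₂∩K : ∀ x → mem B₁ x ⇔ (mem U₂ x × mem K x)
      B₁⇔U₂∩K x = ⇔-trans (⇔-sym (U₁∩K≐B₁ x)) (avoids x)

    avoidingJoin⇒dims : ∀ {i j d₁ d₂} → InAvoidingJoin U₁ U₂ i j K →
                        Dim (U₁ ∩ˢ K) d₁ → Dim (U₂ ∩ˢ K) d₂ → d₁ ≡ i × d₂ ≡ i
    avoidingJoin⇒dims (B₁ , _ , _ , dim-B₁ , _ , _ , U₁∩K≐B₁ , _ , avoids) dim₁ dim₂ =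
      dimMod-unique ZeroSubspace dim₁ dim-B₁ (λ x → Equivalence.to (U₁∩K≐B₁ x)) (λ x → Equivalence.from (U₁∩K≐B₁ x)) ,
      dimMod-unique ZeroSubspace dim₂ dim-B₁ (λ x → Equivalence.to (⇔-trans (⇔-sym (avoids x)) (U₁∩K≐B₁ x)))
                                             (λ x → Equivalence.to (⇔-trans (⇔-sym (U₁∩K≐B₁ x)) (avoids x)))

    avoidingJoin-intro : ∀ {i j} → U₁ ⊆ U₂ → Dim (U₁ ∩ˢ K) i → Dim (U₂ ∩ˢ K) i → DimMod (mem U₂) (mem K) j →
                         InAvoidingJoin U₁ U₂ i j K
    avoidingJoin-intro U₁⊆U₂ dim₁ dim₂ dimMod-K =
      U₁ ∩ˢ K , U₂ +ˢ K , (λ _ → proj₁) , dim₁ ,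
      (λ x x∈U₂ → x , 𝟎 , x∈U₂ , 0∈ K , sym (G.identityʳ x)) , dimMod-+ˢ⁺ U₂ K dimMod-K ,
      (λ _ → ⇔-refl) , (λ _ → ⇔-refl) , avoids
      where
      U₁∩K⊆U₂∩K : ∀ x → mem (U₁ ∩ˢ K) x → mem (U₂ ∩ˢ K) x
      U₁∩K⊆U₂∩K x (x∈U₁ , x∈K) = U₁⊆U₂ x x∈U₁ , x∈K
      avoids : Avoids K U₁ U₂
      avoids x = mk⇔ (U₁∩K⊆U₂∩K x) (⊆-with-equal-dim⇒⊇ (U₁ ∩ˢ K) dim₁ dim₂ U₁∩K⊆U₂∩K x)

  module _ {v} (Z W : Subspace v) (Z? : Decidable (mem Z)) (W? : Decidable (mem W))
           {i k} (dim-Z∩W : Dim (Z ∩ˢ W) i) (dim-W : Dim W k) where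

    dimMod-complement : ∃ λ e → DimMod (mem Z) (mem W) e × i + e ≡ k
    dimMod-complement with dimMod-exists Z Z? (mem W) W?
    ... | e , dimMod-W = e , dimMod-W ,
      dimMod-unique ZeroSubspace (dimension-formula Z W dim-Z∩W dimMod-W) dim-W (λ _ w → w) (λ _ w → w)

    dimMod-∸ : DimMod (mem Z) (mem W) (k ∸ i)
    dimMod-∸ with dimMod-complement
    ... | e , dimMod-W , refl = subst (DimMod (mem Z) (mem W)) (sym (ℕ.m+n∸m≡n i e)) dimMod-W

    dim≤suc-if-spanned-by-one : ∀ y → (∀ x → mem W x → InSpan Z (y ∷ []) x) → k ≤ suc i
    dim≤suc-if-spanned-by-one y W⊆span with dimMod-complement
    ... | e , (g , g∈W , g-ind , _) , refl =
      subst (i + e ≤_) (ℕ.+-comm i 1) (ℕ.+-monoʳ-≤ i (steinitz Z (y ∷ []) g-ind (All.map (λ {x} → W⊆span x) g∈W)))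

  independent-full⇒spans : ∀ {v} {a : Vec (Vect v) v} → Independent ZeroSubspace a → ∀ x → InSpan ZeroSubspace a x
  independent-full⇒spans {v} {a} ind x with inSpan? ZeroSubspace isZero? a x
  ... | yes x∈span = x∈span
  ... | no x∉span = contradiction (independent⇒length≤dim ZeroSubspace (∷-independent ZeroSubspace ind x∉span)) (ℕ.n≮n v)

  module _ {v d} (W : Subspace v) {y : Vect v} {a : Vec (Vect v) d} (a∈W : All (mem W) a) where

    span-∷⇒span-mod : ∀ x → InSpan ZeroSubspace (y ∷ a) x → InSpan W (y ∷ []) x
    span-∷⇒span-mod x (c₀ ∷ cs , x∼) =
      c₀ ∷ [] , ∼-trans W (0⊆ W _ x∼) (⊕-cong W (∼-reflexive W refl) (∈⇒∼𝟎 W (lincomb-∈ W cs a∈W)))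

    span-∷⇒span : ¬ mem W y → ∀ x → mem W x → InSpan ZeroSubspace (y ∷ a) x → InSpan ZeroSubspace a x
    span-∷⇒span y∉W x x∈W (c₀ ∷ cs , x∼) with c₀ ≟ᶠ 0#
    ... | yes refl = cs , ∼-reflexive ZeroSubspace (trans (∼[0]⇒≡ x∼) (trans (cong (_⊕ L) (0·x≡𝟎 y)) (G.identityˡ L)))
      where L = lincomb cs a
    ... | no c₀≢0 with inverse c₀ c₀≢0
    ... | e , c₀e≡1 = contradiction (subst (mem W) y≡ (·∈ W e (⊖-∈ W x∈W (lincomb-∈ W cs a∈W)))) y∉W
      where
      L = lincomb cs a
      y≡ : e · (x ⊖ L) ≡ y
      y≡ = begin
        e · (x ⊖ L)                  ≡⟨ cong (λ w → e · (w ⊖ L)) (∼[0]⇒≡ x∼) ⟩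
        e · (((c₀ · y) ⊕ L) ⊖ L)     ≡⟨ cong (e ·_) (GP.//-rightDividesʳ L (c₀ · y)) ⟩
        e · (c₀ · y)                 ≡⟨ ·-cancel y c₀e≡1 ⟩
        y                            ∎
        where open ≡-Reasoning

  -- Maximal chains

  module MaximalChain {v} (U : ℕ → Subspace v) (chain : IsMaximalChain v U) where

    U-⊆ : ∀ m → suc m ≤ v → U m ⊆ U (suc m)
    U-⊆ m le = proj₁ (proj₂ (proj₂ chain) m le)

    new : ℕ → Vect v
    new m with suc m ≤? v
    ... | yes le = proj₁ (proj₂ (proj₂ (proj₂ chain) m le))
    ... | no _   = 𝟎

    new-∈ : ∀ m → suc m ≤ v → mem (U (suc m)) (new m) × ¬ mem (U m) (new m)
    new-∈ m le with suc m ≤? v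
    ... | yes le′ = proj₂ (proj₂ (proj₂ (proj₂ chain) m le′))
    ... | no m≰v  = contradiction le m≰v

    basis : (m : ℕ) → Vec (Vect v) m
    basis zero    = []
    basis (suc m) = new m ∷ basis m

    basis-∈ : ∀ m → m ≤ v → All (mem (U m)) (basis m)
    basis-∈ zero    _  = []
    basis-∈ (suc m) le = proj₁ (new-∈ m le) ∷ All.map (λ {x} → U-⊆ m le x) (basis-∈ m (ℕ.<⇒≤ le))

    basis-independent : ∀ m → m ≤ v → Independent ZeroSubspace (basis m)
    basis-independent zero    _  = []-independent ZeroSubspace
    basis-independent (suc m) le = ∷-independent ZeroSubspace (basis-independent m (ℕ.<⇒≤ le)) new∉span
      where
      new∉span : ¬ InSpan ZeroSubspace (basis m) (new m)
      new∉span (c , new∼) =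
        proj₂ (new-∈ m le) (subst (mem (U m)) (sym (∼[0]⇒≡ new∼)) (lincomb-∈ (U m) c (basis-∈ m (ℕ.<⇒≤ le))))

    -- Downward from Uᵥ, spanned by its v independent basis vectors.
    basis-spans : ∀ t m → t + m ≡ v → ∀ x → mem (U m) x → InSpan ZeroSubspace (basis m) x
    basis-spans zero    m refl  x _   = independent-full⇒spans (basis-independent m ℕ.≤-refl) x
    basis-spans (suc t) m t+m≡v x x∈U =
      span-∷⇒span (U m) (basis-∈ m (ℕ.<⇒≤ le)) (proj₂ (new-∈ m le)) x x∈U
        (basis-spans t (suc m) (trans (ℕ.+-suc t m) t+m≡v) x (U-⊆ m le x x∈U))
      where
      le : suc m ≤ v
      le = subst (suc m ≤_) t+m≡v (s≤s (ℕ.m≤n+m m t))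

    chain-dim : ∀ m → m ≤ v → Dim (U m) m
    chain-dim m le = basis m , basis-∈ m le , basis-independent m le , basis-spans (v ∸ m) m (ℕ.m∸n+n≡m le)

    U? : ∀ m → m ≤ v → Decidable (mem (U m))
    U? m le = dim⇒decidable (U m) (chain-dim m le)

    step-spans : ∀ m → suc m ≤ v → ∀ x → mem (U (suc m)) x → InSpan (U m) (new m ∷ []) x
    step-spans m le x x∈U =
      span-∷⇒span-mod (U m) (basis-∈ m (ℕ.<⇒≤ le)) x (proj₂ (proj₂ (proj₂ (chain-dim (suc m) le))) x x∈U)

    module Meets {k} (K : Subspace v) (dim-K : Dim K k) where

      K? : Decidable (mem K)
      K? = dim⇒decidable K dim-K

      private
        meet-dim : ∀ m → m ≤ v → ∃ λ d → Dim (U m ∩ˢ K) d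
        meet-dim m le = dimMod-exists ZeroSubspace isZero? _ (λ x → U? m le x ×-dec K? x)

      -- d m = dim (Uₘ ∩ K); the value 0 for m > v is junk.
      d : ℕ → ℕ
      d m with m ≤? v
      ... | yes le = proj₁ (meet-dim m le)
      ... | no _   = 0

      d-dim : ∀ m → m ≤ v → Dim (U m ∩ˢ K) (d m)
      d-dim m le with m ≤? v
      ... | yes le′ = proj₂ (meet-dim m le′)
      ... | no m≰v  = contradiction le m≰v

      d-mono : ∀ m → suc m ≤ v → d m ≤ d (suc m)
      d-mono m le =
        dimMod-mono ZeroSubspace (d-dim m (ℕ.<⇒≤ le)) (d-dim (suc m) le) (λ x (x∈U , x∈K) → U-⊆ m le x x∈U , x∈K)

      d-slow : ∀ m → suc m ≤ v → d (suc m) ≤ suc (d m)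
      d-slow m le =
        dim≤suc-if-spanned-by-one (U m) (U (suc m) ∩ˢ K) (U? m (ℕ.<⇒≤ le)) (λ x → U? (suc m) le x ×-dec K? x)
          (dimMod-cast {Z = IsZero} Uₘ∩K⇔Uₘ∩Uₘ₊₁∩K (d-dim m (ℕ.<⇒≤ le))) (d-dim (suc m) le)
          (new m) (λ x (x∈U , _) → step-spans m le x x∈U)
        where
        Uₘ∩K⇔Uₘ∩Uₘ₊₁∩K : ∀ x → (mem (U m) x × mem K x) ⇔ (mem (U m) x × (mem (U (suc m)) x × mem K x))
        Uₘ∩K⇔Uₘ∩Uₘ₊₁∩K x = mk⇔ (λ (x∈U , x∈K) → x∈U , U-⊆ m le x x∈U , x∈K) (λ (x∈U , _ , x∈K) → x∈U , x∈K)

      d≤k : ∀ m → m ≤ v → d m ≤ k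
      d≤k m le = dimMod-mono ZeroSubspace (d-dim m le) dim-K (λ _ → proj₂)

      avoidingJoin-at : ∀ m {i} → suc m ≤ v → d m ≡ i → d (suc m) ≡ i → InAvoidingJoin (U m) (U (m + 1)) i (k ∸ i) K
      avoidingJoin-at m le refl d₊≡ rewrite ℕ.+-comm m 1 =
        avoidingJoin-intro (U m) (U (suc m)) K (U-⊆ m le)
          (d-dim m (ℕ.<⇒≤ le)) (subst (Dim (U (suc m) ∩ˢ K)) d₊≡ (d-dim (suc m) le))
          (subst (DimMod (mem (U (suc m))) (mem K)) (cong (k ∸_) d₊≡)
                 (dimMod-∸ (U (suc m)) K (U? (suc m) le) K? (d-dim (suc m) le) dim-K))

      avoidingJoin⇒d : ∀ m {i j} → suc m ≤ v → InAvoidingJoin (U m) (U (m + 1)) i j K → d m ≡ i × d (suc m) ≡ i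
      avoidingJoin⇒d m le join rewrite ℕ.+-comm m 1 =
        avoidingJoin⇒dims (U m) (U (suc m)) K join (d-dim m (ℕ.<⇒≤ le)) (d-dim (suc m) le)

      module From (s : ℕ) (s+k<v : s + k < v) where

        private
          f : ℕ → ℕ
          f j = d (s + j)

          f-suc : ∀ j → f (suc j) ≡ d (suc (s + j))
          f-suc j = cong d (ℕ.+-suc s j)

          in-range : ∀ j → j ≤ k → suc (s + j) ≤ v
          in-range j j≤k = ℕ.≤-trans (s≤s (ℕ.+-monoʳ-≤ s j≤k)) s+k<v

        Piece : ℕ → Set₁
        Piece i = InAvoidingJoin (U (s + i)) (U (s + i + 1)) i (k ∸ i) K

        piece-exists : ∃ λ i → i ≤ k × Piece i
        piece-exists with Plateau.plateau-exists f k f-mono f₊ₖ≤k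
          where
          f-mono : ∀ j → j ≤ k → f j ≤ f (suc j)
          f-mono j j≤k = subst (f j ≤_) (sym (f-suc j)) (d-mono (s + j) (in-range j j≤k))
          f₊ₖ≤k : f (suc k) ≤ k
          f₊ₖ≤k = d≤k (s + suc k) (subst (_≤ v) (sym (ℕ.+-suc s k)) s+k<v)
        ... | i , i≤k , fᵢ≡i , f₊ᵢ≡i = i , i≤k , avoidingJoin-at (s + i) (in-range i i≤k) fᵢ≡i (trans (sym (f-suc i)) f₊ᵢ≡i)

        piece-unique : ∀ {i j} → i ≤ k → j ≤ k → Piece i → Piece j → i ≡ j
        piece-unique {i} {j} i≤k j≤k join-i join-j with avoidingJoin⇒d (s + i) (in-range i i≤k) join-i
                                                     | avoidingJoin⇒d (s + j) (in-range j j≤k) join-j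
        ... | fᵢ≡i , f₊ᵢ≡i | fⱼ≡j , f₊ⱼ≡j =
          Plateau.plateau-unique f k f-slow i≤k j≤k (trans (f-suc i) f₊ᵢ≡i) fᵢ≡i (trans (f-suc j) f₊ⱼ≡j) fⱼ≡j
          where
          f-slow : ∀ j → j ≤ k → f (suc j) ≤ suc (f j)
          f-slow j j≤k = subst (_≤ suc (f j)) (sym (f-suc j)) (d-slow (s + j) (in-range j j≤k))

theorem3p19 : ∀ {q : ℕ} (F : FiniteField q) (v : ℕ) →
    let open Lin F in
    (U : ℕ → Subspace v) → IsMaximalChain v U →
    (k s : ℕ) → k ≤ v → s + k < v →
    let Piece : ℕ → Subspace v → Set₁
        Piece i K = InAvoidingJoin (U (s + i)) (U (s + i + 1)) i (k ∸ i) K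
    in
    ((K : Subspace v) → Dim K k → Σ ℕ λ i → i ≤ k × Piece i K)
    × ((i : ℕ) (K : Subspace v) → i ≤ k → Piece i K → Dim K k)
    × ((i j : ℕ) (K : Subspace v) → i ≤ k → j ≤ k → Piece i K → Piece j K → i ≡ j)
    × gauss q v k
        ≡ sumTo (λ i → q ^ ((s + 1) * (k ∸ i)) * gauss q (s + i) i
                        * gauss q (v ∸ s ∸ i ∸ 1) (k ∸ i)) k
-- k ≤ v is implied by s + k < v.
theorem3p19 {q} F v U chain k s _ s+k<v =
  (λ K dim-K → Meets.From.piece-exists K dim-K s s+k<v) ,
  (λ i K i≤k → piece-dim i K i≤k) ,
  (λ i j K i≤k j≤k piece-i → Meets.From.piece-unique K (piece-dim i K i≤k piece-i) s s+k<v i≤k j≤k piece-i) ,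
  GaussianBinomial.gauss-decomposition q s s+k<v
  where
  open Lin F
  open LinearAlgebra F
  open MaximalChain U chain
  piece-dim : ∀ i K → i ≤ k → InAvoidingJoin (U (s + i)) (U (s + i + 1)) i (k ∸ i) K → Dim K k
  piece-dim i K i≤k join = subst (Dim K) (ℕ.m+[n∸m]≡n i≤k) (avoidingJoin⇒dim (U (s + i)) (U (s + i + 1)) K join)
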